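{- Let $\mathcal{S}=(P,I,M,O)$ be a monotonic stochastic STRIPS with derived MDP $(S,\Sigma,T,\mathbf{E},\mathbf{D})$, ordered by $\supseteq$. Let $x\in S$, $\sigma=(\gamma,\pi)\in\Sigma$ and $\tau=(\alpha,\delta)\in T$. If $x\cap\delta\neq\emptyset$, then $\lceil\mathsf{Pre}_{\sigma,\tau}(\downarrow\{x\})\rceil=\emptyset$; otherwise $\lceil\mathsf{Pre}_{\sigma,\tau}(\downarrow\{x\})\rceil=\{\gamma\cup(x\setminus\alpha)\}$.
   Context: A monotonic stochastic STRIPS is a tuple $(P,I,M,O)$ with $P$ a finite set of conditions, $I,M\subseteq P$, and $O$ a finite set of operators $(\gamma,\pi)$ with $\gamma\subseteq P$ and $\pi$ a probability distribution on pairs $(\alpha,\delta)\in2^P\times2^P$ with $\alpha\cap\delta=\emptyset$. Its derived MDP has $S=2^P$, $\Sigma=O$, $\Sigma_s=\{(\gamma,\pi)\in O\mid s\supseteq\gamma\}$, $T=\{(\alpha,\delta)\mid\exists(\gamma,\pi)\in O,\ \pi(\alpha,\delta)>0\}$, and for $\sigma\in\Sigma_s$, $\tau=(\alpha,\delta)$: $\mathbf{E}(s,\sigma)(\tau)=(s\cup\alpha)\setminus\delta$, $\mathbf{D}(s,\sigma)(\tau)=\pi(\tau)$ ($\mathbf{E}(s,\sigma)$ undefined if $\sigma\notin\Sigma_s$). The order is $s\preceq s'$ iff $s\supseteq s'$; $\downarrow\{x\}=\{s\in S\mid s\supseteq x\}$; for $L\subseteq S$, $\lceil L\rceil$ is the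 set of $\preceq$-maximal (i.e. inclusion-minimal) elements of $L$; $\mathsf{Pre}_{\sigma,\tau}(L)=\{s\in S\mid\sigma\in\Sigma_s,\ \mathbf{E}(s,\sigma)(\tau)\in L\}$.
   Formalization: Each operator's probability distribution π takes rational values. -}

module Defs where

open import Data.Nat using (ℕ)
import Data.Bool.Properties as BoolP
open import Data.Fin.Subset using (Subset; _∩_; _∪_; _─_; _⊇_) renaming (⊥ to ∅)
open import Data.Vec.Properties using (≡-dec)
open import Data.Rational using (ℚ; 0ℚ; 1ℚ; _+_; _<_)
open import Data.List using (List; []; _∷_; foldr; map)
open import Data.List.Relation.Unary.All using (All)
open import Data.List.Membership.Propositional using (_∈_)
open import Data.Product using (_×_; _,_; ∃-syntax)
open import Relation.Nullary using (Dec; yes; no)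
open import Relation.Binary.PropositionalEquality using (_≡_)

-- Conditions P are Fin n; states S = 2^P are Subset n.

-- A finitely supported probability distribution π on pairs (α , δ) ∈ 2^P × 2^P
-- is given by a list of weighted outcomes (rational weights).
record Outcome (n : ℕ) : Set where
  constructor outcome
  field
    add  : Subset n
    del  : Subset n
    prob : ℚ
open Outcome public

_≟ₛ_ : ∀ {n} → (a b : Subset n) → Dec (a ≡ b)
_≟ₛ_ = ≡-dec BoolP._≟_

weight : ∀ {n} → List (Outcome n) → Subset n × Subset n → ℚ
weight [] _ = 0ℚ
weight (outcome a d p ∷ os) (α , δ) with a ≟ₛ α | d ≟ₛ δ
... | yes _ | yes _ = p + weight os (α , δ)
... | _     | _     = weight os (α , δ)

totalWeight : ∀ {n} → List (Outcome n) → ℚ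
totalWeight os = foldr _+_ 0ℚ (map prob os)

record Operator (n : ℕ) : Set where
  constructor operator
  field
    pre       : Subset n
    outcomes  : List (Outcome n)
    positive  : All (λ o → 0ℚ < prob o) outcomes
    sumOne    : totalWeight outcomes ≡ 1ℚ
    disjoint  : All (λ o → add o ∩ del o ≡ ∅) outcomes
open Operator public

π : ∀ {n} → Operator n → Subset n × Subset n → ℚ
π σ = weight (outcomes σ)

record STRIPS : Set where
  constructor strips
  field
    n : ℕ
    I : Subset n
    M : Subset n
    O : List (Operator n)
open STRIPS public

State : STRIPS → Set
State 𝒮 = Subset (n 𝒮)

InΣ : (𝒮 : STRIPS) → Operator (n 𝒮) → Set
InΣ 𝒮 σ = σ ∈ O 𝒮

Enabled : (𝒮 : STRIPS) → State 𝒮 → Operator (n 𝒮) → Set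
Enabled 𝒮 s σ = σ ∈ O 𝒮 × s ⊇ pre σ

InT : (𝒮 : STRIPS) → Subset (n 𝒮) × Subset (n 𝒮) → Set
InT 𝒮 τ = ∃[ σ ] (σ ∈ O 𝒮 × 0ℚ < π σ τ)

-- E(s , σ)(τ) (only used when σ ∈ Σ_s)
E : ∀ {m} → Subset m → Operator m → Subset m × Subset m → Subset m
E s σ (α , δ) = (s ∪ α) ─ δ

D : ∀ {m} → Subset m → Operator m → Subset m × Subset m → ℚ
D s σ τ = π σ τ

_≼_ : ∀ {m} → Subset m → Subset m → Set
s ≼ s' = s ⊇ s'

↓ : ∀ {m} → Subset m → Subset m → Set
↓ x s = s ⊇ x

⌈_⌉ : ∀ {m} → (Subset m → Set) → Subset m → Set
⌈ L ⌉ s = L s × (∀ s' → L s' → s ≼ s' → s' ≼ s)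

Pre : (𝒮 : STRIPS) → Operator (n 𝒮) → Subset (n 𝒮) × Subset (n 𝒮)
    → (State 𝒮 → Set) → State 𝒮 → Set
Pre 𝒮 σ τ L s = Enabled 𝒮 s σ × L (E s σ τ)

module Submission where

-- Write σ = (γ , π) and τ = (α , δ).  By definition s lies in
-- Pre_{σ,τ}(↓{x}) iff σ ∈ O, s ⊇ γ and (s ∪ α) ∖ δ ⊇ x.  Elementwise, the
-- last condition says that no element of x is deleted (x ∩ δ = ∅) and that
-- every element of x not added by α was already in s (s ⊇ x ∖ α).  Hence
--   * if x ∩ δ ≠ ∅, the preimage is empty, so it has no maximal element;
--   * if x ∩ δ = ∅, the preimage is the principal down-set ↓{γ ∪ (x ∖ α)},
--     whose unique ≼-maximal element is its generator.

open import Defs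
open import Data.Fin.Subset using (_∩_; _∪_; _─_) renaming (⊥ to ∅)
open import Data.Product using (_×_; _,_)
open import Relation.Binary.PropositionalEquality using (_≡_; _≢_)
open import Relation.Nullary using (¬_)
open import Function.Bundles using (_⇔_)

open import Data.Nat using (ℕ)
open import Data.Fin using (Fin; zero)
open import Data.Fin.Subset using (Subset; _∈_; _∉_; _⊇_; inside; outside)
open import Data.Fin.Subset.Properties
  using (_∈?_; ⊆-refl; ⊆-antisym; p⊆p∪q; q⊆p∪q; x∈p∪q⁻; x∈p∪q⁺; x∈p∩q⁺; x∈p∩q⁻; ∉⊥; Empty-unique)
open import Data.Vec.Base using (_∷_; here; there)
open import Data.Product using (proj₁; proj₂; ∃-syntax)
open import Data.Sum using (inj₁; inj₂; [_,_])
open import Relation.Nullary using (yes; no; contradiction)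
open import Relation.Binary.PropositionalEquality using (refl; subst)
open import Function.Bundles using (mk⇔; Equivalence)
open Equivalence using (to; from)

private
  variable
    m : ℕ
    i : Fin m

x∈p─q⁻ : (p q : Subset m) → i ∈ p ─ q → i ∈ p × i ∉ q
x∈p─q⁻            (inside ∷ p)  (outside ∷ q) here = here , λ ()
x∈p─q⁻ {i = zero} (_ ∷ p)       (inside ∷ q)  ()
x∈p─q⁻ {i = zero} (outside ∷ p) (outside ∷ q) ()
x∈p─q⁻            (_ ∷ p)       (_ ∷ q)       (there i∈p─q) with x∈p─q⁻ p q i∈p─q
... | i∈p , i∉q = there i∈p , λ { (there i∈q) → i∉q i∈q }

x∈p─q⁺ : (p q : Subset m) → i ∈ p → i ∉ q → i ∈ p ─ q
x∈p─q⁺ (inside ∷ p) (outside ∷ q) here i∉q = here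
x∈p─q⁺ (inside ∷ p) (inside ∷ q)  here i∉q with () ← i∉q here
x∈p─q⁺ (_ ∷ p)      (_ ∷ q)       (there i∈p) i∉q =
  there (x∈p─q⁺ p q i∈p (λ i∈q → i∉q (there i∈q)))

⊇-∪ : (s p q : Subset m) → s ⊇ (p ∪ q) ⇔ (s ⊇ p × s ⊇ q)
⊇-∪ s p q = mk⇔ split join
  where
    split : s ⊇ (p ∪ q) → s ⊇ p × s ⊇ q
    split s⊇p∪q = (λ i∈p → s⊇p∪q (p⊆p∪q q i∈p)) , (λ i∈q → s⊇p∪q (q⊆p∪q p q i∈q))

    join : s ⊇ p × s ⊇ q → s ⊇ (p ∪ q)
    join (s⊇p , s⊇q) i∈p∪q = [ s⊇p , s⊇q ] (x∈p∪q⁻ p q i∈p∪q)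

covers-after-effect : (s α δ x : Subset m) →
  ((s ∪ α) ─ δ) ⊇ x ⇔ (x ∩ δ ≡ ∅ × s ⊇ (x ─ α))
covers-after-effect s α δ x = mk⇔ necessary sufficient
  where
    survives : ((s ∪ α) ─ δ) ⊇ x → i ∈ x → i ∈ s ∪ α × i ∉ δ
    survives covers i∈x = x∈p─q⁻ (s ∪ α) δ (covers i∈x)

    necessary : ((s ∪ α) ─ δ) ⊇ x → x ∩ δ ≡ ∅ × s ⊇ (x ─ α)
    necessary covers = Empty-unique x∩δ-empty , already-present
      where
        x∩δ-empty : ¬ (∃[ i ] i ∈ x ∩ δ)
        x∩δ-empty (i , i∈x∩δ) with x∈p∩q⁻ x δ i∈x∩δ
        ... | i∈x , i∈δ = proj₂ (survives covers i∈x) i∈δ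

        already-present : s ⊇ (x ─ α)
        already-present i∈x─α with x∈p─q⁻ x α i∈x─α
        ... | i∈x , i∉α with x∈p∪q⁻ s α (proj₁ (survives covers i∈x))
        ...   | inj₁ i∈s = i∈s
        ...   | inj₂ i∈α = contradiction i∈α i∉α

    sufficient : x ∩ δ ≡ ∅ × s ⊇ (x ─ α) → ((s ∪ α) ─ δ) ⊇ x
    sufficient (x∩δ≡∅ , s⊇x─α) {i} i∈x = x∈p─q⁺ (s ∪ α) δ in-s∪α not-deleted
      where
        not-deleted : i ∉ δ
        not-deleted i∈δ = ∉⊥ (subst (i ∈_) x∩δ≡∅ (x∈p∩q⁺ (i∈x , i∈δ)))

        in-s∪α : i ∈ s ∪ α
        in-s∪α with i ∈? α
        ... | yes i∈α = x∈p∪q⁺ (inj₂ i∈α)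
        ... | no  i∉α = x∈p∪q⁺ (inj₁ (s⊇x─α (x∈p─q⁺ x α i∈x i∉α)))

maximal-of-principal : (L : Subset m → Set) (y : Subset m) →
  (∀ s → L s ⇔ ↓ y s) → ∀ s → ⌈ L ⌉ s ⇔ (s ≡ y)
maximal-of-principal L y L≡↓y s = mk⇔ is-generator generator-is-maximal
  where
    y∈L : L y
    y∈L = from (L≡↓y y) ⊆-refl

    is-generator : ⌈ L ⌉ s → s ≡ y
    is-generator (s∈L , maximal) = ⊆-antisym (maximal y y∈L s⊇y) s⊇y
      where
        s⊇y : s ⊇ y
        s⊇y = to (L≡↓y s) s∈L

    generator-is-maximal : s ≡ y → ⌈ L ⌉ s
    generator-is-maximal refl = y∈L , λ s' s'∈L _ → to (L≡↓y s') s'∈L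

preimage-empty : (𝒮 : STRIPS) (x : State 𝒮) (σ : Operator (n 𝒮)) (α δ : State 𝒮) →
  x ∩ δ ≢ ∅ → ∀ s → ¬ Pre 𝒮 σ (α , δ) (↓ x) s
preimage-empty 𝒮 x σ α δ x∩δ≢∅ s (_ , covers) =
  x∩δ≢∅ (proj₁ (to (covers-after-effect s α δ x) covers))

preimage-principal : (𝒮 : STRIPS) (x : State 𝒮) (σ : Operator (n 𝒮)) (α δ : State 𝒮) →
  InΣ 𝒮 σ → x ∩ δ ≡ ∅ →
  ∀ s → Pre 𝒮 σ (α , δ) (↓ x) s ⇔ ↓ (pre σ ∪ (x ─ α)) s
preimage-principal 𝒮 x σ α δ σ∈O x∩δ≡∅ s = mk⇔ bounded reaches
  where
    bounded : Pre 𝒮 σ (α , δ) (↓ x) s → s ⊇ (pre σ ∪ (x ─ α))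
    bounded ((_ , s⊇γ) , covers) =
      from (⊇-∪ s (pre σ) (x ─ α)) (s⊇γ , proj₂ (to (covers-after-effect s α δ x) covers))

    reaches : s ⊇ (pre σ ∪ (x ─ α)) → Pre 𝒮 σ (α , δ) (↓ x) s
    reaches s⊇bound with to (⊇-∪ s (pre σ) (x ─ α)) s⊇bound
    ... | s⊇γ , s⊇x─α =
      (σ∈O , s⊇γ) , from (covers-after-effect s α δ x) (x∩δ≡∅ , s⊇x─α)

proposition6 : (𝒮 : STRIPS) (x : State 𝒮) (σ : Operator (n 𝒮))
    (α δ : State 𝒮) → InΣ 𝒮 σ → InT 𝒮 (α , δ) →
    ((x ∩ δ ≢ ∅) → ∀ s → ¬ ⌈ Pre 𝒮 σ (α , δ) (↓ x) ⌉ s)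
    × ((x ∩ δ ≡ ∅) → ∀ s → ⌈ Pre 𝒮 σ (α , δ) (↓ x) ⌉ s ⇔ (s ≡ pre σ ∪ (x ─ α)))
proposition6 𝒮 x σ α δ σ∈O _ =
  (λ x∩δ≢∅ s maximal → preimage-empty 𝒮 x σ α δ x∩δ≢∅ s (proj₁ maximal)) ,
  (λ x∩δ≡∅ → maximal-of-principal (Pre 𝒮 σ (α , δ) (↓ x)) (pre σ ∪ (x ─ α))
                 (preimage-principal 𝒮 x σ α δ σ∈O x∩δ≡∅))
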